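{- Let $A$ be a formula with $c(A)=n$, let $T_A$ be the $\mathbf{RWBL}$ reduction of $A$, and let $b$ be any branch of $T_A$. Then $|\langle b\rangle|=O(n^3)$ and $|\langle T_A\rangle|=2^{O(n)}$, where the implicit constants are independent of $A$ and $b$.
   Context: Formulas are built from the constant $\bot$ and propositional variables $p_0,p_1,\dots$ by the binary connectives $\odot,\rightarrow$. $c(A)$ is the number of connective occurrences in $A$. The symbol $\top$ stands for $\bot\rightarrow\bot$ and is treated as an atomic constant. Atomic formulas are the variables, $\bot$ and $\top$. $A<_cB$ means $c(A)<c(B)$, or $c(A)=c(B)$ and $A$ precedes $B$ in a fixed lexicographic order. A relational sequent is $\Gamma\triangleleft\Delta$, with $\Gamma,\Delta$ finite multisets of formulas and $\triangleleft\in\{\ll\}\cup\{\preccurlyeq_z,\prec_z:z\in\mathbb Z\}$; if $\triangleleft$ is $\ll$ then $|\Gamma|,|\Delta|\le1$. We write $\preccurlyeq,\prec$ for index $0$. A relational hypersequent is a finite set of relational sequents, written $S_1|\dots|S_k$, where $|$ also denotes union. It is irreducible if all formulas are atomic. Abbreviations (each a hypersequent): - $\overline{A\ll B}=A\preccurlyeq B|B\preccurlyeq A|B\ll A$; - $\overline{A\le B}=B\prec A|B\ll A$; - $\overline{A\preccurlyeq B}=A\ll B|B\prec A|B\ll A$; - $\overline{A\prec B}=A\ll B|B\preccurlyeq A|B\ll A$; - $\overline{A\sim B}=A\ll B|B\ll A$; - $\overline{\preccurlyeq_1A,B}=\overline{A\sim B}|\overline{A\ll\top}|\overline{B\ll\top}|A,B\prec_{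 -1}$; - $\overline{A,B\prec_{ -1}}=\overline{A\sim B}|\overline{A\ll\top}|\overline{B\ll\top}|\preccurlyeq_1A,B$. Antecedents: - $I_{\odot_1}=\overline{A\ll B}$, $I_{\odot_2}=\overline{B\ll A}$, $I_{\odot_3}=\overline{\preccurlyeq_1A,B}$, $I_{\odot_4}=\overline{A,B\prec_{ -1}}$, $I_{\odot_5}=\overline{\top\preccurlyeq A}|\overline{\top\preccurlyeq B}$; - $I_{\rightarrow_1}=\overline{B\ll A}$, $I_{\rightarrow_2}=\overline{B\prec A}$, $I_{\rightarrow_3}=\overline{A\le B}$. Rewriting rules. Let $G$ be a relational hypersequent whose most complex formula w.r.t. $<_c$ is the pivot $A\circ B$. Let: - $H$ be the set of sequents of $G$ not containing $A\circ B$; - $G'$ be the set of $\ll$-sequents containing it; - $G''$ be the set of $\preccurlyeq_z/\prec_z$-sequents containing it; - $G'''\subseteq G''$ be those with relation $\preccurlyeq$ (index $0$) and at most one formula per side. Let $C=A$ if $A<_cB$, else $C=B$. Substitutions act on each sequent: - $X(D\Leftarrow E)$ replaces every occurrence of $D$ by $E$; - $X(D\Leftarrow E,E')$ replaces every occurrence of $D$ by $E,E'$; - for $l$ left and $r$ right occurrences of $A\odot B$, $(A\odot B\Leftarrow A,B\triangleleft_{+l-r}A,B)$ deletes them, adds one copy of $A,B$ on each side, and changes index $z$ to $z+l-r$; - for $l$ left and $r$ right occurrences of $A\rightarrow B$, $(A\rightarrow B\Leftarrow A^r,B^l\triangleleft A^l,B^r)$ deletes them, adds $r$ copies of $A$ and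 $l$ of $B$ on the left, and $l$ of $A$ and $r$ of $B$ on the right. Premises of $(\odot)$, in order, are $I_{\odot_i}|G_{\odot_i}$ with: - $G_{\odot_1}=G(A\odot B\Leftarrow A)|H$; - $G_{\odot_2}=G(A\odot B\Leftarrow B)|H$; - $G_{\odot_3}=G'(A\odot B\Leftarrow C)|G''(A\odot B\Leftarrow A,B)|H$; - $G_{\odot_4}=G'(A\odot B\Leftarrow C)|G''(A\odot B\Leftarrow A,B\triangleleft_{+l-r}A,B)|H$; - $G_{\odot_5}=G'(A\odot B\Leftarrow\top)|G'''(A\odot B\Leftarrow\top)|H$. Premises of $(\rightarrow)$ are $I_{\rightarrow_i}|G_{\rightarrow_i}$ with: - $G_{\rightarrow_1}=G(A\rightarrow B\Leftarrow B)|H$; - $G_{\rightarrow_2}=G'(A\rightarrow B\Leftarrow C)|G''(A\rightarrow B\Leftarrow A^r,B^l\triangleleft A^l,B^r)|H$; - $G_{\rightarrow_3}=G'(A\rightarrow B\Leftarrow\top)|G'''(A\rightarrow B\Leftarrow\top)|H$. The $\mathbf{RWBL}$ reduction $T_A$: the root is labeled $\top\preccurlyeq A$; a node with irreducible label is a leaf; a node with reducible label $G$ has as children, in order, nodes labeled by the premises of the rewriting rule whose conclusion is $G$ and whose pivot is the most complex formula of $G$. A branch is a path from the root to a leaf. Sizes: formulas and hypersequents are strings over the ASCII alphabet with standard binary encoding $\langle\cdot\rangle$. The size of a hypersequent $G$ is $|\langle G\rangle|$, which is proportional to its number of occurrences of connectives, atoms and relations. The size $|\langle b\rangle|$ of a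 branch is the sum of the sizes of its node labels; $|\langle T_A\rangle|$ is the sum of the sizes of all node labels of $T_A$. -}

module Defs where

open import Data.Nat using (ℕ; zero; suc; _+_; _<ᵇ_; _≡ᵇ_; _≤ᵇ_)
open import Data.Integer using (ℤ; +_; -[1+_])
import Data.Integer as Int
open import Data.Integer.Properties using () renaming (_≟_ to _≟ℤ_)
open import Data.Bool using (Bool; true; false; _∧_; _∨_; if_then_else_; not; T)
open import Data.List using (List; []; _∷_; _++_; map; concatMap; filter; foldr; replicate; length; deduplicateᵇ; [_])
open import Data.Bool.ListAction using (any; all)
open import Data.Nat.ListAction using (sum)
open import Data.Maybe using (Maybe; just; nothing)
open import Data.List.Membership.Propositional using (_∈_)
open import Data.List.Relation.Binary.Pointwise using (Pointwise)
open import Relation.Nullary using (¬_; does)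
open import Function using (_∘_)

infixr 7 _⊙_
infixr 6 _⇒_

data Fm : Set where
  bot : Fm
  top : Fm
  var : ℕ → Fm
  _⊙_ : Fm → Fm → Fm
  _⇒_ : Fm → Fm → Fm

cc : Fm → ℕ
cc bot = 0
cc top = 0
cc (var _) = 0
cc (a ⊙ b) = suc (cc a + cc b)
cc (a ⇒ b) = suc (cc a + cc b)

atomic : Fm → Bool
atomic bot = true
atomic top = true
atomic (var _) = true
atomic (_ ⊙ _) = false
atomic (_ ⇒ _) = false

-- The fixed lexicographic order: lexicographic order of the Polish
-- (prefix) notation strings over the alphabet bot < top < p_i < ⊙ < ⇒,
-- with p_i < p_j iff i < j.

data Cmp : Set where
  lt eq gt : Cmp

cmpN : ℕ → ℕ → Cmp
cmpN m n = if m <ᵇ n then lt else (if m ≡ᵇ n then eq else gt)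

thenC : Cmp → Cmp → Cmp
thenC eq c = c
thenC lt _ = lt
thenC gt _ = gt

tag : Fm → ℕ
tag bot = 0
tag top = 1
tag (var _) = 2
tag (_ ⊙ _) = 3
tag (_ ⇒ _) = 4

cmpF : Fm → Fm → Cmp
cmpF bot bot = eq
cmpF top top = eq
cmpF (var i) (var j) = cmpN i j
cmpF (a ⊙ b) (c ⊙ d) = thenC (cmpF a c) (cmpF b d)
cmpF (a ⇒ b) (c ⇒ d) = thenC (cmpF a c) (cmpF b d)
cmpF x y = cmpN (tag x) (tag y)

isLt isEq isGt : Cmp → Bool
isLt lt = true
isLt _ = false
isEq eq = true
isEq _ = false
isGt gt = true
isGt _ = false

eqF : Fm → Fm → Bool
eqF a b = isEq (cmpF a b)

_<c_ : Fm → Fm → Bool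
a <c b = (cc a <ᵇ cc b) ∨ ((cc a ≡ᵇ cc b) ∧ isLt (cmpF a b))

data Rl : Set where
  ≪ : Rl
  ≼ : ℤ → Rl
  ≺ : ℤ → Rl

record Seq : Set where
  constructor _▹[_]_
  field
    ante : List Fm
    rel  : Rl
    succ : List Fm
open Seq public

-- a hypersequent is a finite set of sequents; represented by a list,
-- kept in canonical form by `norm` (sides sorted, duplicates removed)
HS : Set
HS = List Seq

insertF : Fm → List Fm → List Fm
insertF x [] = x ∷ []
insertF x (y ∷ ys) = if isGt (cmpF x y) then y ∷ insertF x ys else x ∷ y ∷ ys

sortF : List Fm → List Fm
sortF = foldr insertF []

eqL : List Fm → List Fm → Bool
eqL [] [] = true
eqL (x ∷ xs) (y ∷ ys) = eqF x y ∧ eqL xs ys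
eqL _ _ = false

eqZ : ℤ → ℤ → Bool
eqZ z w = does (z ≟ℤ w)

eqR : Rl → Rl → Bool
eqR ≪ ≪ = true
eqR (≼ z) (≼ w) = eqZ z w
eqR (≺ z) (≺ w) = eqZ z w
eqR _ _ = false

sortSeq : Seq → Seq
sortSeq (g ▹[ r ] d) = sortF g ▹[ r ] sortF d

eqSeq : Seq → Seq → Bool
eqSeq (g ▹[ r ] d) (g' ▹[ r' ] d') = eqL g g' ∧ eqR r r' ∧ eqL d d'

norm : HS → HS
norm G = deduplicateᵇ eqSeq (map sortSeq G)

z0 : ℤ
z0 = + 0

_≪'_ _≼'_ _≺'_ : Fm → Fm → Seq
a ≪' b = [ a ] ▹[ ≪ ] [ b ]
a ≼' b = [ a ] ▹[ ≼ z0 ] [ b ]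
a ≺' b = [ a ] ▹[ ≺ z0 ] [ b ]

nLl nLe nPre nStr nSim nPre1 nStr1 : Fm → Fm → HS
nLl a b = (a ≼' b) ∷ (b ≼' a) ∷ (b ≪' a) ∷ []
nLe a b = (b ≺' a) ∷ (b ≪' a) ∷ []
nPre a b = (a ≪' b) ∷ (b ≺' a) ∷ (b ≪' a) ∷ []
nStr a b = (a ≪' b) ∷ (b ≼' a) ∷ (b ≪' a) ∷ []
nSim a b = (a ≪' b) ∷ (b ≪' a) ∷ []
nPre1 a b = nSim a b ++ nLl a top ++ nLl b top ++ ((a ∷ b ∷ []) ▹[ ≺ -[1+ 0 ] ] [] ) ∷ []
nStr1 a b = nSim a b ++ nLl a top ++ nLl b top ++ ([] ▹[ ≼ (+ 1) ] (a ∷ b ∷ [])) ∷ []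

mapSides : (List Fm → List Fm) → Seq → Seq
mapSides f (g ▹[ r ] d) = f g ▹[ r ] f d

sub1 : Fm → Fm → Seq → Seq
sub1 p e = mapSides (map (λ x → if eqF p x then e else x))

sub2 : Fm → Fm → Fm → Seq → Seq
sub2 p e e' = mapSides (concatMap (λ x → if eqF p x then e ∷ e' ∷ [] else x ∷ []))

count : Fm → List Fm → ℕ
count p xs = length (filter (λ x → T? (eqF p x)) xs)
  where
  open import Relation.Nullary.Decidable using () renaming (T? to T?)

removeAll : Fm → List Fm → List Fm
removeAll p = filter (λ x → T? (not (eqF p x)))
  where
  open import Relation.Nullary.Decidable using () renaming (T? to T?)

shiftR : ℤ → Rl → Rl
shiftR k ≪ = ≪
shiftR k (≼ z) = ≼ (z Int.+ k)
shiftR k (≺ z) = ≺ (z Int.+ k)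

subShift : Fm → Fm → Fm → Seq → Seq
subShift p a b (g ▹[ r ] d) =
  (removeAll p g ++ a ∷ b ∷ []) ▹[ shiftR ((+ count p g) Int.- (+ count p d)) r ] (removeAll p d ++ a ∷ b ∷ [])

subImp : Fm → Fm → Fm → Seq → Seq
subImp p a b (g ▹[ r ] d) =
  (removeAll p g ++ replicate (count p d) a ++ replicate (count p g) b) ▹[ r ]
  (removeAll p d ++ replicate (count p g) a ++ replicate (count p d) b)

contains : Fm → Seq → Bool
contains p s = any (eqF p) (ante s ++ succ s)

isLl : Rl → Bool
isLl ≪ = true
isLl _ = false

isPre0 : Rl → Bool
isPre0 (≼ z) = eqZ z z0
isPre0 _ = false

filt : (Seq → Bool) → HS → HS
filt f = filter (λ s → T? (f s))
  where
  open import Relation.Nullary.Decidable using () renaming (T? to T?)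

partH partG' partG'' partG''' : Fm → HS → HS
partH p = filt (λ s → not (contains p s))
partG' p = filt (λ s → contains p s ∧ isLl (rel s))
partG'' p = filt (λ s → contains p s ∧ not (isLl (rel s)))
partG''' p G = filt (λ s → isPre0 (rel s) ∧ (length (ante s) ≤ᵇ 1) ∧ (length (succ s) ≤ᵇ 1)) (partG'' p G)

chooseC : Fm → Fm → Fm
chooseC a b = if a <c b then a else b

premises : Fm → HS → List HS
premises bot G = []
premises top G = []
premises (var _) G = []
premises p@(a ⊙ b) G = map norm
  ( (nLl a b ++ map (sub1 p a) G ++ H)
  ∷ (nLl b a ++ map (sub1 p b) G ++ H)
  ∷ (nPre1 a b ++ map (sub1 p (chooseC a b)) (partG' p G) ++ map (sub2 p a b) (partG'' p G) ++ H)
  ∷ (nStr1 a b ++ map (sub1 p (chooseC a b)) (partG' p G) ++ map (subShift p a b) (partG'' p G) ++ H)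
  ∷ ((nPre top a ++ nPre top b) ++ map (sub1 p top) (partG' p G) ++ map (sub1 p top) (partG''' p G) ++ H)
  ∷ [])
  where H = partH p G
premises p@(a ⇒ b) G = map norm
  ( (nLl b a ++ map (sub1 p b) G ++ H)
  ∷ (nStr b a ++ map (sub1 p (chooseC a b)) (partG' p G) ++ map (subImp p a b) (partG'' p G) ++ H)
  ∷ (nLe a b ++ map (sub1 p top) (partG' p G) ++ map (sub1 p top) (partG''' p G) ++ H)
  ∷ [])
  where H = partH p G

fmls : HS → List Fm
fmls = concatMap (λ s → ante s ++ succ s)

maxF : List Fm → Maybe Fm
maxF [] = nothing
maxF (x ∷ xs) with maxF xs
... | nothing = just x
... | just m = just (if m <c x then x else m)

pivot : HS → Maybe Fm
pivot G with maxF (fmls G)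
... | nothing = nothing
... | just m = if atomic m then nothing else just m

Irreducible : HS → Set
Irreducible G = T (all atomic (fmls G))

children : HS → List HS
children G with pivot G
... | nothing = []
... | just p = premises p G

root : Fm → HS
root A = norm ((top ≼' A) ∷ [])

data Branch : HS → List HS → Set where
  leaf : ∀ {G} → Irreducible G → Branch G (G ∷ [])
  step : ∀ {G G₁ bs} → ¬ Irreducible G → G₁ ∈ children G → Branch G₁ bs → Branch G (G ∷ bs)

-- Sizes: number of occurrences of connectives, atoms and relations

sizeF : Fm → ℕ
sizeF (a ⊙ b) = suc (sizeF a + sizeF b)
sizeF (a ⇒ b) = suc (sizeF a + sizeF b)
sizeF _ = 1

sizeSeq : Seq → ℕ
sizeSeq s = suc (sum (map sizeF (ante s)) + sum (map sizeF (succ s)))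

sizeHS : HS → ℕ
sizeHS G = sum (map sizeSeq G)

branchSize : List HS → ℕ
branchSize bs = sum (map sizeHS bs)

-- TreeSize G s : the (finite) reduction tree with root labelled G exists
-- and s is the sum of the sizes of all its node labels
data TreeSize : HS → ℕ → Set where
  leaf : ∀ {G} → Irreducible G → TreeSize G (sizeHS G)
  node : ∀ {G ss} → ¬ Irreducible G → Pointwise TreeSize (children G) ss →
         TreeSize G (sizeHS G + sum ss)

{-# OPTIONS --safe #-}
module Submission where

-- Every node G of T_A satisfies Invariant ℓ m β G: G has at most ℓ sequents, each of them
-- weighs at most β when formulas common to both sides are counted once, and the compound
-- formulas of G lie in a list whose connective counts sum to at most m.  A rewriting step
-- with pivot p = a ∘ b replaces p by a, b or ⊤ in the old sequents, which keeps their
-- weight below β because |a| + |b| < |p| (the rules copying a and b to both sides put them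
-- in the shared part); it adds at most 9 sequents over a, b and ⊤; and it trades p for a
-- and b in the list.  Duplicate sequents, such as the second copy of H in the first
-- premises, are merged by norm.  So ℓ grows by 9 and m drops by 1 at each step.  The root
-- has ℓ = 1, m = n = c(A) and β = 2n + 2, hence every node has size at most
-- (1 + 9n)(4n + 5), a branch has at most n + 1 nodes and a node at most 5 children,
-- which gives O(n³) and 6ⁿ · O(n²) = 2^O(n).

open import Defs
open import Data.Bool using (Bool; true; false; not; T; if_then_else_; _∧_)
open import Data.Bool.ListAction using (any; all)
open import Data.Bool.Properties using (T-not-≡)
open import Data.Empty using (⊥-elim)
open import Data.Integer.Properties using () renaming (_≟_ to _≟ℤ_)
open import Data.List using (List; []; _∷_; _++_; map; filter; length; replicate; concatMap; deduplicateᵇ)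
import Data.List.Properties as List
open import Data.List.Membership.Propositional using (_∈_; _─_; find; lose)
open import Data.List.Membership.Propositional.Properties
  using (∈-map⁺; ∈-map⁻; ∈-++⁺ˡ; ∈-++⁺ʳ; ∈-++⁻; ∈-filter⁻; ∈-concatMap⁺; ∈-concatMap⁻; ∈-deduplicate⁻)
open import Data.List.Relation.Binary.Permutation.Propositional
  using (_↭_; prep; swap; ↭-refl; ↭-trans; ↭-reflexive)
import Data.List.Relation.Binary.Permutation.Propositional.Properties as ↭
open import Data.List.Relation.Binary.Pointwise using (Pointwise; []; _∷_)
open import Data.List.Relation.Binary.Subset.Propositional using (_⊆_)
import Data.List.Relation.Binary.Subset.Propositional.Properties as ⊆
open import Data.List.Relation.Unary.All using (All; []; _∷_)
import Data.List.Relation.Unary.All as All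
import Data.List.Relation.Unary.All.Properties as All
import Data.List.Relation.Unary.AllPairs as AllPairs
open import Data.List.Relation.Unary.Any using (here; there; index)
open import Data.List.Relation.Unary.Unique.Propositional using (Unique)
import Data.List.Relation.Unary.Unique.Propositional.Properties as Unique
open import Data.Maybe using (just; nothing)
open import Data.Maybe.Properties using (just-injective)
open import Data.Nat using (ℕ; zero; suc; _+_; _*_; _^_; _≤_; _<_; z≤n; s≤s; >-nonZero)
open import Data.Nat.ListAction using (sum)
open import Data.Nat.ListAction.Properties using (sum-++; sum-↭)
import Data.Nat.Properties as ℕ
open import Algebra.Properties.CommutativeSemigroup ℕ.+-commutativeSemigroup using (x∙yz≈y∙xz)
open import Data.Nat.Tactic.RingSolver using (solve-∀)
open import Data.Product using (Σ; ∃; _×_; _,_; proj₁; proj₂)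
import Data.Product as Product
open import Data.Sum using (_⊎_; inj₁; inj₂)
import Data.Sum as Sum
open import Function using (_∘_)
open import Function.Bundles using (Equivalence)
open import Relation.Binary.PropositionalEquality
  using (_≡_; _≢_; refl; sym; trans; cong; cong₂; subst; subst₂)
open import Relation.Nullary using (¬?; yes; no)
open import Relation.Nullary.Decidable using (T?; dec-true)

module _ {A : Set} where

  ∈-─ : ∀ {x y : A} {xs} (i : x ∈ xs) → y ∈ xs → y ≢ x → y ∈ xs ─ i
  ∈-─ (here refl) (here refl) y≢x = ⊥-elim (y≢x refl)
  ∈-─ (here refl) (there j) _ = j
  ∈-─ (there i) (here refl) _ = here refl
  ∈-─ (there i) (there j) y≢x = there (∈-─ i j y≢x)

  sum-map-─ : (f : A → ℕ) {x : A} {xs : List A} (i : x ∈ xs) → f x + sum (map f (xs ─ i)) ≡ sum (map f xs)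
  sum-map-─ f (here refl) = refl
  sum-map-─ f {x} (there {y} i) = trans (x∙yz≈y∙xz (f x) (f y) _) (cong (f y +_) (sum-map-─ f i))

  unique-⊆⇒length≤ : ∀ {xs ys : List A} → Unique xs → xs ⊆ ys → length xs ≤ length ys
  unique-⊆⇒length≤ AllPairs.[] _ = z≤n
  unique-⊆⇒length≤ {x ∷ xs} {ys} (x∉xs AllPairs.∷ xs-unique) xs⊆ys =
    subst (suc (length xs) ≤_) (sym (List.length-removeAt′ ys (index x∈ys)))
      (s≤s (unique-⊆⇒length≤ xs-unique λ y∈xs →
        ∈-─ x∈ys (xs⊆ys (there y∈xs)) λ y≡x → All.lookup x∉xs y∈xs (sym y≡x)))
    where x∈ys = xs⊆ys (here refl)

  deduplicateᵇ-unique : (r : A → A → Bool) → (∀ x → T (r x x)) → ∀ xs → Unique (deduplicateᵇ r xs)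
  deduplicateᵇ-unique r r-refl [] = AllPairs.[]
  deduplicateᵇ-unique r r-refl (x ∷ xs) =
    All.map (λ ¬rxy x≡y → ¬rxy (subst (T ∘ r x) x≡y (r-refl x))) (All.all-filter distinct (deduplicateᵇ r xs))
    AllPairs.∷ Unique.filter⁺ distinct (deduplicateᵇ-unique r r-refl xs)
    where distinct = λ y → ¬? (T? (r x y))

  ¬any⇒all : (f : A → Bool) → ∀ xs → any f xs ≡ false → All (λ x → f x ≡ false) xs
  ¬any⇒all f [] _ = []
  ¬any⇒all f (x ∷ xs) e with f x in fx
  ... | false = fx ∷ ¬any⇒all f xs e

  replicate-+ : ∀ m n (x : A) → replicate (m + n) x ≡ replicate m x ++ replicate n x
  replicate-+ zero n x = refl
  replicate-+ (suc m) n x = cong (x ∷_) (replicate-+ m n x)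

  ++-interchange : (ws xs ys zs : List A) → (ws ++ xs) ++ (ys ++ zs) ↭ (ws ++ ys) ++ (xs ++ zs)
  ++-interchange ws xs ys zs =
    subst₂ _↭_ (sym (List.++-assoc ws xs (ys ++ zs))) (sym (List.++-assoc ws ys (xs ++ zs)))
      (↭.++⁺ˡ ws (↭.shifts xs ys))

  concatMap-↭ : {B : Set} (f : A → List B) {xs ys : List A} → xs ↭ ys → concatMap f xs ↭ concatMap f ys
  concatMap-↭ f _↭_.refl = ↭-refl
  concatMap-↭ f (prep x xs↭ys) = ↭.++⁺ˡ (f x) (concatMap-↭ f xs↭ys)
  concatMap-↭ f (swap x y xs↭ys) =
    ↭-trans (↭.++⁺ˡ (f x) (↭.++⁺ˡ (f y) (concatMap-↭ f xs↭ys))) (↭.shifts (f x) (f y))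
  concatMap-↭ f (_↭_.trans xs↭ys ys↭zs) = ↭-trans (concatMap-↭ f xs↭ys) (concatMap-↭ f ys↭zs)

  sum-map≤length* : (f : A → ℕ) {c : ℕ} (xs : List A) → (∀ {x} → x ∈ xs → f x ≤ c) →
                    sum (map f xs) ≤ length xs * c
  sum-map≤length* f [] _ = z≤n
  sum-map≤length* f (x ∷ xs) f≤c = ℕ.+-mono-≤ (f≤c (here refl)) (sum-map≤length* f xs (f≤c ∘ there))

  pointwise-sum≤ : {P : A → ℕ → Set} {c : ℕ} (xs : List A) → (∀ {x} → x ∈ xs → ∃ λ n → P x n × n ≤ c) →
                   ∃ λ ns → Pointwise P xs ns × sum ns ≤ length xs * c
  pointwise-sum≤ [] _ = [] , [] , z≤n
  pointwise-sum≤ (x ∷ xs) bound =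
    let n , Pxn , n≤c = bound (here refl) ; ns , Pxsns , sum≤ = pointwise-sum≤ xs (bound ∘ there)
    in n ∷ ns , Pxn ∷ Pxsns , ℕ.+-mono-≤ n≤c sum≤

cmpN-refl : ∀ i → cmpN i i ≡ eq
cmpN-refl zero = refl
cmpN-refl (suc i) = cmpN-refl i

cmpN≡eq⇒≡ : ∀ i j → cmpN i j ≡ eq → i ≡ j
cmpN≡eq⇒≡ zero zero _ = refl
cmpN≡eq⇒≡ (suc i) (suc j) e = cong suc (cmpN≡eq⇒≡ i j e)

cmpF-refl : ∀ x → cmpF x x ≡ eq
cmpF-refl bot = refl
cmpF-refl top = refl
cmpF-refl (var i) = cmpN-refl i
cmpF-refl (a ⊙ b) rewrite cmpF-refl a = cmpF-refl b
cmpF-refl (a ⇒ b) rewrite cmpF-refl a = cmpF-refl b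

thenC≡eq : ∀ c d → thenC c d ≡ eq → c ≡ eq × d ≡ eq
thenC≡eq eq d e = refl , e

cmpF≡eq⇒≡ : ∀ x y → cmpF x y ≡ eq → x ≡ y
cmpF≡eq⇒≡ bot bot _ = refl
cmpF≡eq⇒≡ top top _ = refl
cmpF≡eq⇒≡ (var i) (var j) e = cong var (cmpN≡eq⇒≡ i j e)
cmpF≡eq⇒≡ (a ⊙ b) (c ⊙ d) e =
  let a≡c , b≡d = thenC≡eq (cmpF a c) (cmpF b d) e in cong₂ _⊙_ (cmpF≡eq⇒≡ a c a≡c) (cmpF≡eq⇒≡ b d b≡d)
cmpF≡eq⇒≡ (a ⇒ b) (c ⇒ d) e =
  let a≡c , b≡d = thenC≡eq (cmpF a c) (cmpF b d) e in cong₂ _⇒_ (cmpF≡eq⇒≡ a c a≡c) (cmpF≡eq⇒≡ b d b≡d)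

eqF-refl : ∀ x → eqF x x ≡ true
eqF-refl x rewrite cmpF-refl x = refl

eqF⇒≡ : ∀ x y → eqF x y ≡ true → x ≡ y
eqF⇒≡ x y e with cmpF x y in c
... | eq = cmpF≡eq⇒≡ x y c

¬eqF⇒≢ : ∀ p x → eqF p x ≡ false → x ≢ p
¬eqF⇒≢ p .p e refl with () ← trans (sym (eqF-refl p)) e

sizeF>0 : ∀ x → 0 < sizeF x
sizeF>0 bot = s≤s z≤n
sizeF>0 top = s≤s z≤n
sizeF>0 (var _) = s≤s z≤n
sizeF>0 (_ ⊙ _) = s≤s z≤n
sizeF>0 (_ ⇒ _) = s≤s z≤n

compound⇒cc>0 : ∀ x → atomic x ≡ false → 0 < cc x
compound⇒cc>0 (_ ⊙ _) _ = s≤s z≤n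
compound⇒cc>0 (_ ⇒ _) _ = s≤s z≤n

formulas : Seq → List Fm
formulas s = ante s ++ succ s

insertF-↭ : ∀ x ys → insertF x ys ↭ x ∷ ys
insertF-↭ x [] = ↭-refl
insertF-↭ x (y ∷ ys) with isGt (cmpF x y)
... | true = ↭-trans (prep y (insertF-↭ x ys)) (swap y x ↭-refl)
... | false = ↭-refl

sortF-↭ : ∀ xs → sortF xs ↭ xs
sortF-↭ [] = ↭-refl
sortF-↭ (x ∷ xs) = ↭-trans (insertF-↭ x (sortF xs)) (prep x (sortF-↭ xs))

formulas-sortSeq : ∀ s → formulas (sortSeq s) ⊆ formulas s
formulas-sortSeq s = ↭.∈-resp-↭ (↭.++⁺ (sortF-↭ (ante s)) (sortF-↭ (succ s)))

eqL-refl : ∀ xs → eqL xs xs ≡ true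
eqL-refl [] = refl
eqL-refl (x ∷ xs) rewrite eqF-refl x = eqL-refl xs

eqR-refl : ∀ r → eqR r r ≡ true
eqR-refl ≪ = refl
eqR-refl (≼ z) = dec-true (z ≟ℤ z) refl
eqR-refl (≺ z) = dec-true (z ≟ℤ z) refl

eqSeq-refl : ∀ s → T (eqSeq s s)
eqSeq-refl (g ▹[ r ] d) rewrite eqL-refl g | eqR-refl r | eqL-refl d = _

∈-norm⁻ : ∀ {s G} → s ∈ norm G → ∃ λ t → t ∈ G × s ≡ sortSeq t
∈-norm⁻ {G = G} s∈ = ∈-map⁻ sortSeq (∈-deduplicate⁻ _ (map sortSeq G) s∈)

length-norm : ∀ {G M} → G ⊆ M → length (norm G) ≤ length M
length-norm {G} {M} G⊆M =
  subst (length (norm G) ≤_) (List.length-map sortSeq M)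
    (unique-⊆⇒length≤ (deduplicateᵇ-unique eqSeq eqSeq-refl (map sortSeq G)) λ s∈ →
      let t , t∈G , s≡ = ∈-norm⁻ s∈ in subst (_∈ map sortSeq M) (sym s≡) (∈-map⁺ sortSeq (G⊆M t∈G)))

∈-fmls⁻ : ∀ {x} G → x ∈ fmls G → ∃ λ s → s ∈ G × x ∈ formulas s
∈-fmls⁻ G x∈ = find (∈-concatMap⁻ formulas {G} x∈)

∈-fmls⁺ : ∀ {x s G} → s ∈ G → x ∈ formulas s → x ∈ fmls G
∈-fmls⁺ s∈G x∈s = ∈-concatMap⁺ formulas (lose s∈G x∈s)

weight : List Fm → ℕ
weight xs = sum (map sizeF xs)

weight-++ : ∀ xs ys → weight (xs ++ ys) ≡ weight xs + weight ys
weight-++ xs ys = trans (cong sum (List.map-++ sizeF xs ys)) (sum-++ (map sizeF xs) (map sizeF ys))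

weight-↭ : ∀ {xs ys} → xs ↭ ys → weight xs ≡ weight ys
weight-↭ xs↭ys = sum-↭ (↭.map⁺ sizeF xs↭ys)

weight-replicate : ∀ n x → weight (replicate n x) ≡ n * sizeF x
weight-replicate zero x = refl
weight-replicate (suc n) x = cong (sizeF x +_) (weight-replicate n x)

∈⇒sizeF≤weight : ∀ {x xs} → x ∈ xs → sizeF x ≤ weight xs
∈⇒sizeF≤weight (here refl) = ℕ.m≤m+n _ _
∈⇒sizeF≤weight {xs = y ∷ _} (there x∈) = ℕ.≤-trans (∈⇒sizeF≤weight x∈) (ℕ.m≤n+m _ (sizeF y))

module _ (p : Fm) where

  removeAll-++ : ∀ xs ys → removeAll p (xs ++ ys) ≡ removeAll p xs ++ removeAll p ys
  removeAll-++ = List.filter-++ _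

  removeAll-↭ : ∀ {xs ys} → xs ↭ ys → removeAll p xs ↭ removeAll p ys
  removeAll-↭ = ↭.filter-↭ _

  count-++ : ∀ xs ys → count p (xs ++ ys) ≡ count p xs + count p ys
  count-++ xs ys = trans (cong length (List.filter-++ _ xs ys)) (List.length-++ (filter _ xs))

  count-↭ : ∀ {xs ys} → xs ↭ ys → count p xs ≡ count p ys
  count-↭ xs↭ys = ↭.↭-length (↭.filter-↭ _ xs↭ys)

  any⇒count>0 : ∀ xs → any (eqF p) xs ≡ true → 0 < count p xs
  any⇒count>0 (x ∷ xs) e with eqF p x
  ... | true = s≤s z≤n
  ... | false = any⇒count>0 xs e

  weight-removeAll : ∀ xs → weight (removeAll p xs) + count p xs * sizeF p ≡ weight xs
  weight-removeAll [] = refl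
  weight-removeAll (x ∷ xs) with eqF p x in p≡x
  ... | true = trans (x∙yz≈y∙xz (weight (removeAll p xs)) (sizeF p) _)
                     (cong₂ _+_ (cong sizeF (eqF⇒≡ p x p≡x)) (weight-removeAll xs))
  ... | false = trans (ℕ.+-assoc (sizeF x) _ _) (cong (sizeF x +_) (weight-removeAll xs))

-- Formulas on both sides are weighed once, since the rules for ⊙ and → copy the
-- immediate subformulas of the pivot to both sides of a sequent.
record Bounded (β : ℕ) (s : Seq) : Set where
  constructor bounded
  field
    onlyLeft onlyRight shared : List Fm
    ante↭ : ante s ↭ onlyLeft ++ shared
    succ↭ : succ s ↭ onlyRight ++ shared
    weight≤ : weight onlyLeft + weight onlyRight + weight shared ≤ β

module _ {β s} (s-bounded : Bounded β s) where
  open Bounded s-bounded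
  open ℕ.≤-Reasoning

  weight-ante≤ : weight (ante s) ≤ β
  weight-ante≤ = begin
    weight (ante s)                                    ≡⟨ weight-↭ ante↭ ⟩
    weight (onlyLeft ++ shared)                        ≡⟨ weight-++ onlyLeft shared ⟩
    weight onlyLeft + weight shared                    ≤⟨ ℕ.+-monoˡ-≤ (weight shared) L≤L+R ⟩
    weight onlyLeft + weight onlyRight + weight shared ≤⟨ weight≤ ⟩
    β                                                  ∎
    where L≤L+R = ℕ.m≤m+n (weight onlyLeft) (weight onlyRight)

  weight-succ≤ : weight (succ s) ≤ β
  weight-succ≤ = begin
    weight (succ s)                                    ≡⟨ weight-↭ succ↭ ⟩
    weight (onlyRight ++ shared)                       ≡⟨ weight-++ onlyRight shared ⟩
    weight onlyRight + weight shared                   ≤⟨ ℕ.+-monoˡ-≤ (weight shared) R≤L+R ⟩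
    weight onlyLeft + weight onlyRight + weight shared ≤⟨ weight≤ ⟩
    β                                                  ∎
    where R≤L+R = ℕ.m≤n+m (weight onlyRight) (weight onlyLeft)

  sizeSeq≤ : sizeSeq s ≤ suc (β + β)
  sizeSeq≤ = s≤s (ℕ.+-mono-≤ weight-ante≤ weight-succ≤)

  sizeF≤ : ∀ {x} → x ∈ formulas s → sizeF x ≤ β
  sizeF≤ x∈ with ∈-++⁻ (ante s) x∈
  ... | inj₁ x∈ante = ℕ.≤-trans (∈⇒sizeF≤weight x∈ante) weight-ante≤
  ... | inj₂ x∈succ = ℕ.≤-trans (∈⇒sizeF≤weight x∈succ) weight-succ≤

  sortSeq-bounded : Bounded β (sortSeq s)
  sortSeq-bounded =
    bounded onlyLeft onlyRight shared (↭-trans (sortF-↭ (ante s)) ante↭) (↭-trans (sortF-↭ (succ s)) succ↭) weight≤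

-- Decomposing the pivot

-- The old sequents in a premise: G′ rewritten by f, G″ (or G‴) by g, and H unchanged.
onPivot : Fm → (Seq → Seq) → (Seq → Seq) → Seq → Seq
onPivot p f g s = if contains p s then (if isLl (rel s) then f s else g s) else s

module _ (p : Fm) where

  onPivot-G′ : ∀ f g s → T (contains p s ∧ isLl (rel s)) → onPivot p f g s ≡ f s
  onPivot-G′ f g s _ with contains p s | isLl (rel s)
  ... | true | true = refl

  onPivot-G″ : ∀ f g s → T (contains p s ∧ not (isLl (rel s))) → onPivot p f g s ≡ g s
  onPivot-G″ f g s _ with contains p s | isLl (rel s)
  ... | true | false = refl

  onPivot-H : ∀ f g s → T (not (contains p s)) → onPivot p f g s ≡ s
  onPivot-H f g s _ with contains p s
  ... | false = refl

  partition-⊆ : ∀ f g G → map f (partG' p G) ++ map g (partG'' p G) ++ partH p G ⊆ map (onPivot p f g) G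
  partition-⊆ f g G t∈ with ∈-++⁻ (map f (partG' p G)) t∈
  ... | inj₁ t∈G′ =
    let s , s∈ , t≡fs = ∈-map⁻ f t∈G′ ; s∈G , s-in-G′ = ∈-filter⁻ _ {xs = G} s∈
    in subst (_∈ _) (trans (onPivot-G′ f g s s-in-G′) (sym t≡fs)) (∈-map⁺ (onPivot p f g) s∈G)
  ... | inj₂ t∈rest with ∈-++⁻ (map g (partG'' p G)) t∈rest
  ...   | inj₁ t∈G″ =
    let s , s∈ , t≡gs = ∈-map⁻ g t∈G″ ; s∈G , s-in-G″ = ∈-filter⁻ _ {xs = G} s∈
    in subst (_∈ _) (trans (onPivot-G″ f g s s-in-G″) (sym t≡gs)) (∈-map⁺ (onPivot p f g) s∈G)
  ...   | inj₂ t∈H =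
    let t∈G , t-in-H = ∈-filter⁻ _ {xs = G} t∈H
    in subst (_∈ _) (onPivot-H f g _ t-in-H) (∈-map⁺ (onPivot p f g) t∈G)

  partition‴-⊆ : ∀ f G → map f (partG' p G) ++ map f (partG''' p G) ++ partH p G ⊆ map (onPivot p f f) G
  partition‴-⊆ f G =
    partition-⊆ f f G ∘ ⊆.++⁺ʳ (map f (partG' p G)) (⊆.++⁺ˡ (partH p G) (⊆.map⁺ f (⊆.filter-⊆ _ (partG'' p G))))

  absent : ∀ s → contains p s ≡ false → All (λ x → eqF p x ≡ false) (formulas s)
  absent s = ¬any⇒all (eqF p) (formulas s)

  sub1-absent : ∀ e s → contains p s ≡ false → sub1 p e s ≡ s
  sub1-absent e (g ▹[ r ] d) p∉s =
    let p∉g , p∉d = All.++⁻ g (absent (g ▹[ r ] d) p∉s) in cong₂ (_▹[ r ]_) (unchanged p∉g) (unchanged p∉d)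
    where
    unchanged : ∀ {xs} → All (λ x → eqF p x ≡ false) xs → map (λ x → if eqF p x then e else x) xs ≡ xs
    unchanged = List.map-id-local ∘ All.map (cong (if_then e else _))

  sub1-⊆ : ∀ e G → map (sub1 p e) G ++ partH p G ⊆ map (sub1 p e) G
  sub1-⊆ e G t∈ with ∈-++⁻ (map (sub1 p e) G) t∈
  ... | inj₁ t∈sub1G = t∈sub1G
  ... | inj₂ t∈H =
    let t∈G , p∉t = ∈-filter⁻ _ {xs = G} t∈H
    in subst (_∈ _) (sub1-absent e _ (Equivalence.to T-not-≡ p∉t)) (∈-map⁺ (sub1 p e) t∈G)

data Introduced (a b : Fm) : Fm → Set where
  sub₁ : Introduced a b a
  sub₂ : Introduced a b b
  ⊤ : Introduced a b top

chooseC-introduced : ∀ a b → Introduced a b (chooseC a b)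
chooseC-introduced a b with a <c b
... | true = sub₁
... | false = sub₂

module Decomposition (p a b : Fm) (a+b<p : sizeF a + sizeF b < sizeF p) where

  Decomposes : List Fm → List Fm → Set
  Decomposes xs ys = ∀ {y} → y ∈ ys → Introduced a b y ⊎ (y ∈ xs × y ≢ p)

  Reduct : ℕ → Seq → Seq → Set
  Reduct β s t = Bounded β t × Decomposes (formulas s) (formulas t)

  decomposes-⊆ : ∀ {xs xs′ ys} → xs ⊆ xs′ → Decomposes xs ys → Decomposes xs′ ys
  decomposes-⊆ xs⊆ dec = Sum.map₂ (Product.map₁ xs⊆) ∘ dec

  decomposes-sides : ∀ s t → Decomposes (ante s) (ante t) → Decomposes (succ s) (succ t) →
                     Decomposes (formulas s) (formulas t)
  decomposes-sides s t dec-ante dec-succ y∈ with ∈-++⁻ (ante t) y∈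
  ... | inj₁ y∈ante = decomposes-⊆ ∈-++⁺ˡ dec-ante y∈ante
  ... | inj₂ y∈succ = decomposes-⊆ (∈-++⁺ʳ (ante s)) dec-succ y∈succ

  introduced≤p : ∀ {e} → Introduced a b e → sizeF e ≤ sizeF p
  introduced≤p sub₁ = ℕ.≤-trans (ℕ.m≤m+n (sizeF a) (sizeF b)) (ℕ.<⇒≤ a+b<p)
  introduced≤p sub₂ = ℕ.≤-trans (ℕ.m≤n+m (sizeF b) (sizeF a)) (ℕ.<⇒≤ a+b<p)
  introduced≤p ⊤ = sizeF>0 p

  weight-a,b≤p : weight (a ∷ b ∷ []) ≤ sizeF p
  weight-a,b≤p = subst (_≤ sizeF p) (cong (sizeF a +_) (sym (ℕ.+-identityʳ (sizeF b)))) (ℕ.<⇒≤ a+b<p)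

  absent-reduct : ∀ {β s} → contains p s ≡ false → Bounded β s → Reduct β s s
  absent-reduct {s = s} p∉s s-bounded = s-bounded , λ y∈ → inj₂ (y∈ , ¬eqF⇒≢ p _ (All.lookup (absent p s p∉s) y∈))

  onPivot-reduct : ∀ {f g : Seq → Seq} →
    (∀ {β s} → contains p s ≡ true → Bounded β s → Reduct β s (f s)) →
    (∀ {β s} → contains p s ≡ true → Bounded β s → Reduct β s (g s)) →
    ∀ {β s} → Bounded β s → Reduct β s (onPivot p f g s)
  onPivot-reduct f-reduct g-reduct {s = s} s-bounded with contains p s in occurs
  ... | false = absent-reduct occurs s-bounded
  ... | true with isLl (rel s)
  ...   | true = f-reduct occurs s-bounded
  ...   | false = g-reduct occurs s-bounded

  -- Both substitutions X(D ⇐ E) and X(D ⇐ E,E′) replace each occurrence of p by a list.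
  replace : List Fm → Fm → List Fm
  replace es x = if eqF p x then es else x ∷ []

  module _ (es : List Fm) (es-introduced : All (Introduced a b) es) (weight-es : weight es ≤ sizeF p) where

    weight-replace : ∀ x → weight (replace es x) ≤ sizeF x
    weight-replace x with eqF p x in p≡x
    ... | true = subst (weight es ≤_) (cong sizeF (eqF⇒≡ p x p≡x)) weight-es
    ... | false = ℕ.≤-reflexive (ℕ.+-identityʳ (sizeF x))

    weight-concatMap-replace : ∀ xs → weight (concatMap (replace es) xs) ≤ weight xs
    weight-concatMap-replace [] = z≤n
    weight-concatMap-replace (x ∷ xs) =
      subst (_≤ weight (x ∷ xs)) (sym (weight-++ (replace es x) (concatMap (replace es) xs)))
        (ℕ.+-mono-≤ (weight-replace x) (weight-concatMap-replace xs))

    decomposes-replace : ∀ x → Decomposes (x ∷ []) (replace es x)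
    decomposes-replace x y∈ with eqF p x in p≡x | y∈
    ... | true | y∈es = inj₁ (All.lookup es-introduced y∈es)
    ... | false | here refl = inj₂ (here refl , ¬eqF⇒≢ p x p≡x)

    decomposes-concatMap-replace : ∀ xs → Decomposes xs (concatMap (replace es) xs)
    decomposes-concatMap-replace xs y∈ with find (∈-concatMap⁻ (replace es) {xs} y∈)
    ... | x , x∈xs , y∈replace with decomposes-replace x y∈replace
    ...   | inj₁ introduced = inj₁ introduced
    ...   | inj₂ (here refl , y≢p) = inj₂ (x∈xs , y≢p)

    replace-reduct : ∀ {β s} → Bounded β s → Reduct β s (mapSides (concatMap (replace es)) s)
    replace-reduct {s = g ▹[ r ] d} (bounded L R Z g↭ d↭ weight≤) =
      bounded (replaced L) (replaced R) (replaced Z)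
        (subst (replaced g ↭_) (List.concatMap-++ (replace es) L Z) (concatMap-↭ (replace es) g↭))
        (subst (replaced d ↭_) (List.concatMap-++ (replace es) R Z) (concatMap-↭ (replace es) d↭))
        (ℕ.≤-trans (ℕ.+-mono-≤ (ℕ.+-mono-≤ (weight-concatMap-replace L) (weight-concatMap-replace R))
                               (weight-concatMap-replace Z))
                   weight≤) ,
      decomposes-sides (g ▹[ r ] d) (replaced g ▹[ r ] replaced d)
        (decomposes-concatMap-replace g) (decomposes-concatMap-replace d)
      where replaced = concatMap (replace es)

  map-substitute≡concatMap-replace : ∀ e xs →
    map (λ x → if eqF p x then e else x) xs ≡ concatMap (replace (e ∷ [])) xs
  map-substitute≡concatMap-replace e [] = refl
  map-substitute≡concatMap-replace e (x ∷ xs) with eqF p x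
  ... | true = cong (e ∷_) (map-substitute≡concatMap-replace e xs)
  ... | false = cong (x ∷_) (map-substitute≡concatMap-replace e xs)

  sub1-reduct : ∀ {e β s} → Introduced a b e → Bounded β s → Reduct β s (sub1 p e s)
  sub1-reduct {e} {s = g ▹[ r ] d} e-introduced
    rewrite map-substitute≡concatMap-replace e g | map-substitute≡concatMap-replace e d =
    replace-reduct (e ∷ []) (e-introduced ∷ [])
      (subst (_≤ sizeF p) (sym (ℕ.+-identityʳ (sizeF e))) (introduced≤p e-introduced))

  sub2-reduct : ∀ {β s} → Bounded β s → Reduct β s (sub2 p a b s)
  sub2-reduct = replace-reduct (a ∷ b ∷ []) (sub₁ ∷ sub₂ ∷ []) weight-a,b≤p

  decomposes-removeAll : ∀ {es} xs → All (Introduced a b) es → Decomposes xs (removeAll p xs ++ es)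
  decomposes-removeAll xs es-introduced y∈ with ∈-++⁻ (removeAll p xs) y∈
  ... | inj₁ y∈removed =
    let y∈xs , p≢y = ∈-filter⁻ (λ x → T? (not (eqF p x))) {xs = xs} y∈removed
    in inj₂ (y∈xs , ¬eqF⇒≢ p _ (Equivalence.to T-not-≡ p≢y))
  ... | inj₂ y∈es = inj₁ (All.lookup es-introduced y∈es)

  -- Removing every p from a sequent and adding es and fs to its sides, as (A⊙B ⇐ A,B ◁ A,B)
  -- and (A→B ⇐ Aʳ,Bˡ ◁ Aˡ,Bʳ) do.
  module RemoveAll {β g r d} (s-bounded : Bounded β (g ▹[ r ] d)) where
    open Bounded s-bounded public

    occurrences : ℕ
    occurrences = count p onlyLeft + count p onlyRight + count p shared

    count-ante : count p g ≡ count p onlyLeft + count p shared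
    count-ante = trans (count-↭ p ante↭) (count-++ p onlyLeft shared)

    count-succ : count p d ≡ count p onlyRight + count p shared
    count-succ = trans (count-↭ p succ↭) (count-++ p onlyRight shared)

    occurrences>0 : contains p (g ▹[ r ] d) ≡ true → 0 < occurrences
    occurrences>0 occurs = half>0 (ℕ.<-≤-trans (any⇒count>0 p (g ++ d) occurs) count≤)
      where
      count≤ : count p (g ++ d) ≤ occurrences + occurrences
      count≤ rewrite count-++ p g d | count-ante | count-succ =
        ℕ.+-mono-≤ (ℕ.+-monoˡ-≤ (count p shared) (ℕ.m≤m+n (count p onlyLeft) (count p onlyRight)))
                   (ℕ.+-monoˡ-≤ (count p shared) (ℕ.m≤n+m (count p onlyRight) (count p onlyLeft)))
      half>0 : ∀ {n} → 0 < n + n → 0 < n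
      half>0 {suc n} _ = s≤s z≤n

    -- cs is added to both sides, so it joins the shared part.
    removeAll-bounded : ∀ {r′ es fs} esₗ fsᵣ cs → es ↭ esₗ ++ cs → fs ↭ fsᵣ ++ cs →
                        weight esₗ + weight fsᵣ + weight cs ≤ occurrences * sizeF p →
                        Bounded β ((removeAll p g ++ es) ▹[ r′ ] (removeAll p d ++ fs))
    removeAll-bounded esₗ fsᵣ cs es↭ fs↭ budget =
      bounded (removeAll p onlyLeft ++ esₗ) (removeAll p onlyRight ++ fsᵣ) (removeAll p shared ++ cs)
        (regroup onlyLeft shared ante↭ es↭) (regroup onlyRight shared succ↭ fs↭) weight≤′
      where
      regroup : ∀ X Z {xs ys ysₓ} → xs ↭ X ++ Z → ys ↭ ysₓ ++ cs →
                removeAll p xs ++ ys ↭ (removeAll p X ++ ysₓ) ++ (removeAll p Z ++ cs)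
      regroup X Z {ysₓ = ysₓ} xs↭ ys↭ =
        ↭-trans (↭.++⁺ (subst (_ ↭_) (removeAll-++ p X Z) (removeAll-↭ p xs↭)) ys↭)
                (++-interchange (removeAll p X) (removeAll p Z) ysₓ cs)
      open ℕ.≤-Reasoning
      L = weight (removeAll p onlyLeft)
      R = weight (removeAll p onlyRight)
      Z = weight (removeAll p shared)
      weight≤′ : weight (removeAll p onlyLeft ++ esₗ) + weight (removeAll p onlyRight ++ fsᵣ)
                 + weight (removeAll p shared ++ cs) ≤ β
      weight≤′ = begin
        weight (removeAll p onlyLeft ++ esₗ) + weight (removeAll p onlyRight ++ fsᵣ)
          + weight (removeAll p shared ++ cs)
          ≡⟨ cong₂ _+_ (cong₂ _+_ (weight-++ (removeAll p onlyLeft) esₗ) (weight-++ (removeAll p onlyRight) fsᵣ))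
                       (weight-++ (removeAll p shared) cs) ⟩
        (L + weight esₗ) + (R + weight fsᵣ) + (Z + weight cs)
          ≡⟨ interchange L (weight esₗ) R (weight fsᵣ) Z (weight cs) ⟩
        (L + R + Z) + (weight esₗ + weight fsᵣ + weight cs)
          ≤⟨ ℕ.+-monoʳ-≤ (L + R + Z) budget ⟩
        (L + R + Z) + occurrences * sizeF p
          ≡⟨ distribute L R Z (count p onlyLeft) (count p onlyRight) (count p shared) (sizeF p) ⟩
        (L + count p onlyLeft * sizeF p) + (R + count p onlyRight * sizeF p) + (Z + count p shared * sizeF p)
          ≡⟨ cong₂ _+_ (cong₂ _+_ (weight-removeAll p onlyLeft) (weight-removeAll p onlyRight))
                       (weight-removeAll p shared) ⟩
        weight onlyLeft + weight onlyRight + weight shared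
          ≤⟨ weight≤ ⟩
        β ∎
        where
        interchange : ∀ l e r f z c → (l + e) + (r + f) + (z + c) ≡ (l + r + z) + (e + f + c)
        interchange = solve-∀
        distribute : ∀ l r z i j k x → (l + r + z) + (i + j + k) * x ≡ (l + i * x) + (r + j * x) + (z + k * x)
        distribute = solve-∀

  subShift-reduct : ∀ {β s} → contains p s ≡ true → Bounded β s → Reduct β s (subShift p a b s)
  subShift-reduct {s = g ▹[ r ] d} occurs s-bounded =
    removeAll-bounded [] [] (a ∷ b ∷ []) ↭-refl ↭-refl budget ,
    decomposes-sides (g ▹[ r ] d) (subShift p a b (g ▹[ r ] d))
      (decomposes-removeAll g (sub₁ ∷ sub₂ ∷ [])) (decomposes-removeAll d (sub₁ ∷ sub₂ ∷ []))
    where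
    open RemoveAll s-bounded
    budget : weight (a ∷ b ∷ []) ≤ occurrences * sizeF p
    budget = ℕ.≤-trans weight-a,b≤p (ℕ.m≤n*m (sizeF p) occurrences {{>-nonZero (occurrences>0 occurs)}})

  weight-replicates : ∀ m n → weight (replicate m a ++ replicate n b) ≡ m * sizeF a + n * sizeF b
  weight-replicates m n =
    trans (weight-++ (replicate m a) (replicate n b)) (cong₂ _+_ (weight-replicate m a) (weight-replicate n b))

  subImp-reduct : ∀ {β s} → Bounded β s → Reduct β s (subImp p a b s)
  subImp-reduct {s = g ▹[ r ] d} s-bounded =
    removeAll-bounded (copies cR cL) (copies cL cR) (copies cZ cZ)
      (regroup cR cL cZ count-succ count-ante) (regroup cL cR cZ count-ante count-succ) budget ,
    decomposes-sides (g ▹[ r ] d) (subImp p a b (g ▹[ r ] d))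
      (decomposes-removeAll g (copies-introduced (count p d) (count p g)))
      (decomposes-removeAll d (copies-introduced (count p g) (count p d)))
    where
    open RemoveAll s-bounded
    cL = count p onlyLeft
    cR = count p onlyRight
    cZ = count p shared
    copies : ℕ → ℕ → List Fm
    copies m n = replicate m a ++ replicate n b
    copies-introduced : ∀ m n → All (Introduced a b) (copies m n)
    copies-introduced m n = All.++⁺ (All.replicate⁺ m sub₁) (All.replicate⁺ n sub₂)
    regroup : ∀ m n k {i j} → i ≡ m + k → j ≡ n + k → copies i j ↭ copies m n ++ copies k k
    regroup m n k refl refl rewrite replicate-+ m k a | replicate-+ n k b =
      ++-interchange (replicate m a) (replicate k a) (replicate n b) (replicate k b)
    open ℕ.≤-Reasoning
    budget : weight (copies cR cL) + weight (copies cL cR) + weight (copies cZ cZ) ≤ occurrences * sizeF p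
    budget = begin
      weight (copies cR cL) + weight (copies cL cR) + weight (copies cZ cZ)
        ≡⟨ cong₂ _+_ (cong₂ _+_ (weight-replicates cR cL) (weight-replicates cL cR)) (weight-replicates cZ cZ) ⟩
      (cR * sizeF a + cL * sizeF b) + (cL * sizeF a + cR * sizeF b) + (cZ * sizeF a + cZ * sizeF b)
        ≡⟨ factorise cL cR cZ (sizeF a) (sizeF b) ⟩
      occurrences * (sizeF a + sizeF b)
        ≤⟨ ℕ.*-monoʳ-≤ occurrences (ℕ.<⇒≤ a+b<p) ⟩
      occurrences * sizeF p ∎
      where
      factorise : ∀ l r z x y → (r * x + l * y) + (l * x + r * y) + (z * x + z * y) ≡ (l + r + z) * (x + y)
      factorise = solve-∀

  record Fresh (β : ℕ) (s : Seq) : Set where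
    constructor fresh
    field
      introduced : All (Introduced a b) (formulas s)
      weight≤ : weight (formulas s) ≤ β

  fresh-bounded : ∀ {β s} → Fresh β s → Bounded β s
  fresh-bounded {β} {g ▹[ r ] d} (fresh _ weight≤) =
    bounded g d [] (↭-reflexive (sym (List.++-identityʳ g))) (↭-reflexive (sym (List.++-identityʳ d)))
      (subst (_≤ β) (trans (weight-++ g d) (sym (ℕ.+-identityʳ _))) weight≤)

  fresh-pair : ∀ {β x y} → Introduced a b x → Introduced a b y → sizeF x + sizeF y ≤ β →
               ∀ {r} → Fresh β ((x ∷ []) ▹[ r ] (y ∷ []))
  fresh-pair {β} {x} {y} x-introduced y-introduced x+y≤β =
    fresh (x-introduced ∷ y-introduced ∷ [])
          (subst (_≤ β) (cong (sizeF x +_) (sym (ℕ.+-identityʳ (sizeF y)))) x+y≤β)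

  module FreshPair {β u v} (u-introduced : Introduced a b u) (v-introduced : Introduced a b v)
                   (u+v≤β : sizeF u + sizeF v ≤ β) where

    u◁v : ∀ {r} → Fresh β ((u ∷ []) ▹[ r ] (v ∷ []))
    u◁v = fresh-pair u-introduced v-introduced u+v≤β

    v◁u : ∀ {r} → Fresh β ((v ∷ []) ▹[ r ] (u ∷ []))
    v◁u = fresh-pair v-introduced u-introduced (subst (_≤ β) (ℕ.+-comm (sizeF u) (sizeF v)) u+v≤β)

    fresh-nLl : All (Fresh β) (nLl u v)
    fresh-nLl = u◁v ∷ v◁u ∷ v◁u ∷ []

    fresh-nLe : All (Fresh β) (nLe u v)
    fresh-nLe = v◁u ∷ v◁u ∷ []

    fresh-nPre : All (Fresh β) (nPre u v)
    fresh-nPre = u◁v ∷ v◁u ∷ v◁u ∷ []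

    fresh-nStr : All (Fresh β) (nStr u v)
    fresh-nStr = u◁v ∷ v◁u ∷ v◁u ∷ []

    fresh-nSim : All (Fresh β) (nSim u v)
    fresh-nSim = u◁v ∷ v◁u ∷ []

-- The invariant

-- pending holds the compound formulas still to be decomposed; a step trades the pivot
-- for its immediate subformulas, so the sum of their connective counts drops by one.
record Invariant (ℓ m β : ℕ) (G : HS) : Set where
  field
    length≤ : length G ≤ ℓ
    sequents-bounded : ∀ {s} → s ∈ G → Bounded β s
    pending : List Fm
    pending-complete : ∀ {x} → x ∈ fmls G → atomic x ≡ false → x ∈ pending
    pending-cc : sum (map cc pending) ≤ m

module RewritingStep {ℓ m β G p} (a b : Fm) (inv : Invariant ℓ (suc m) β G) (p∈G : p ∈ fmls G)
                     (p-compound : atomic p ≡ false) (cc-p : cc p ≡ suc (cc a + cc b))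
                     (sizeF-p : sizeF p ≡ suc (sizeF a + sizeF b)) where
  open Invariant inv
  open Decomposition p a b (ℕ.≤-reflexive (sym sizeF-p)) public

  module Premise (new rest : HS) (f : Seq → Seq) (new≤9 : length new ≤ 9) (new-fresh : All (Fresh β) new)
                 (rest⊆ : rest ⊆ map f G) (f-reduct : ∀ {s} → Bounded β s → Reduct β s (f s)) where

    p∈pending : p ∈ pending
    p∈pending = pending-complete p∈G p-compound

    length≤′ : length (norm (new ++ rest)) ≤ ℓ + 9
    length≤′ = begin
      length (norm (new ++ rest))    ≤⟨ length-norm (⊆.++⁺ʳ new rest⊆) ⟩
      length (new ++ map f G)        ≡⟨ List.length-++ new ⟩
      length new + length (map f G)  ≡⟨ cong (length new +_) (List.length-map f G) ⟩
      length new + length G          ≤⟨ ℕ.+-mono-≤ new≤9 length≤ ⟩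
      9 + ℓ                          ≡⟨ ℕ.+-comm 9 ℓ ⟩
      ℓ + 9                          ∎
      where open ℕ.≤-Reasoning

    origin : ∀ {t} → t ∈ new ++ rest → Bounded β t × Decomposes (fmls G) (formulas t)
    origin t∈ with ∈-++⁻ new t∈
    ... | inj₁ t∈new =
      let t-fresh = All.lookup new-fresh t∈new
      in fresh-bounded t-fresh , inj₁ ∘ All.lookup (Fresh.introduced t-fresh)
    ... | inj₂ t∈rest with ∈-map⁻ f (rest⊆ t∈rest)
    ...   | s , s∈G , refl = Product.map₂ (decomposes-⊆ (∈-fmls⁺ s∈G)) (f-reduct (sequents-bounded s∈G))

    bounded′ : ∀ {s} → s ∈ norm (new ++ rest) → Bounded β s
    bounded′ s∈ with ∈-norm⁻ s∈
    ... | t , t∈ , refl = sortSeq-bounded (proj₁ (origin t∈))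

    complete′ : ∀ {x} → x ∈ fmls (norm (new ++ rest)) → atomic x ≡ false → x ∈ a ∷ b ∷ (pending ─ p∈pending)
    complete′ x∈ x-compound with ∈-fmls⁻ (norm (new ++ rest)) x∈
    ... | s , s∈ , x∈s with ∈-norm⁻ s∈
    ...   | t , t∈ , refl with proj₂ (origin t∈) (formulas-sortSeq t x∈s)
    ...     | inj₁ sub₁ = here refl
    ...     | inj₁ sub₂ = there (here refl)
    ...     | inj₂ (x∈G , x≢p) = there (there (∈-─ p∈pending (pending-complete x∈G x-compound) x≢p))

    cc≤′ : sum (map cc (a ∷ b ∷ (pending ─ p∈pending))) ≤ m
    cc≤′ = ℕ.≤-pred (begin
      suc (cc a + (cc b + rest-cc)) ≡⟨ cong suc (ℕ.+-assoc (cc a) (cc b) rest-cc) ⟨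
      suc (cc a + cc b) + rest-cc   ≡⟨ cong (_+ rest-cc) cc-p ⟨
      cc p + rest-cc                ≡⟨ sum-map-─ cc p∈pending ⟩
      sum (map cc pending)          ≤⟨ pending-cc ⟩
      suc m                         ∎)
      where open ℕ.≤-Reasoning
            rest-cc = sum (map cc (pending ─ p∈pending))

    invariant : Invariant (ℓ + 9) m β (norm (new ++ rest))
    invariant = record
      { length≤ = length≤′
      ; sequents-bounded = bounded′
      ; pending = a ∷ b ∷ (pending ─ p∈pending)
      ; pending-complete = complete′
      ; pending-cc = cc≤′
      }

  a+b≤β : sizeF a + sizeF b ≤ β
  a+b≤β = let s , s∈G , p∈s = ∈-fmls⁻ G p∈G in
    ℕ.<⇒≤ (subst (_≤ β) sizeF-p (sizeF≤ (sequents-bounded s∈G) p∈s))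

  b+a≤β : sizeF b + sizeF a ≤ β
  b+a≤β = subst (_≤ β) (ℕ.+-comm (sizeF a) (sizeF b)) a+b≤β

  a+⊤≤β : sizeF a + sizeF top ≤ β
  a+⊤≤β = ℕ.≤-trans (ℕ.+-monoʳ-≤ (sizeF a) (sizeF>0 b)) a+b≤β

  b+⊤≤β : sizeF b + sizeF top ≤ β
  b+⊤≤β = ℕ.≤-trans (ℕ.+-monoʳ-≤ (sizeF b) (sizeF>0 a)) b+a≤β

  ⊤+a≤β : sizeF top + sizeF a ≤ β
  ⊤+a≤β = subst (_≤ β) (ℕ.+-comm (sizeF a) 1) a+⊤≤β

  ⊤+b≤β : sizeF top + sizeF b ≤ β
  ⊤+b≤β = subst (_≤ β) (ℕ.+-comm (sizeF b) 1) b+⊤≤β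

  fresh-a,b : ∀ {g r d} → g ++ d ≡ a ∷ b ∷ [] → Fresh β (g ▹[ r ] d)
  fresh-a,b g++d≡a,b =
    fresh (subst (All (Introduced a b)) (sym g++d≡a,b) (sub₁ ∷ sub₂ ∷ []))
          (subst (λ xs → weight xs ≤ β) (sym g++d≡a,b)
            (subst (_≤ β) (cong (sizeF a +_) (sym (ℕ.+-identityʳ (sizeF b)))) a+b≤β))

  fresh-I⊙₃₄ : ∀ {s} → Fresh β s → All (Fresh β) (nSim a b ++ nLl a top ++ nLl b top ++ s ∷ [])
  fresh-I⊙₃₄ s-fresh =
    All.++⁺ (FreshPair.fresh-nSim sub₁ sub₂ a+b≤β)
      (All.++⁺ (FreshPair.fresh-nLl sub₁ ⊤ a+⊤≤β) (All.++⁺ (FreshPair.fresh-nLl sub₂ ⊤ b+⊤≤β) (s-fresh ∷ [])))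

⊙-premise-invariant : ∀ {ℓ m β G a b H} → Invariant ℓ (suc m) β G → a ⊙ b ∈ fmls G →
                      H ∈ premises (a ⊙ b) G → Invariant (ℓ + 9) m β H
⊙-premise-invariant {ℓ} {m} {β} {G} {a} {b} inv p∈G = premise
  where
  open RewritingStep a b inv p∈G refl refl refl
  p = a ⊙ b
  premise : ∀ {H} → H ∈ premises p G → Invariant (ℓ + 9) m β H
  premise (here refl) =
    Premise.invariant (nLl a b) _ (sub1 p a) (ℕ.≤ᵇ⇒≤ _ 9 _) (FreshPair.fresh-nLl sub₁ sub₂ a+b≤β)
      (sub1-⊆ p a G) (sub1-reduct sub₁)
  premise (there (here refl)) =
    Premise.invariant (nLl b a) _ (sub1 p b) (ℕ.≤ᵇ⇒≤ _ 9 _) (FreshPair.fresh-nLl sub₂ sub₁ b+a≤β)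
      (sub1-⊆ p b G) (sub1-reduct sub₂)
  premise (there (there (here refl))) =
    Premise.invariant (nPre1 a b) _ (onPivot p (sub1 p (chooseC a b)) (sub2 p a b)) (ℕ.≤ᵇ⇒≤ _ 9 _)
      (fresh-I⊙₃₄ (fresh-a,b refl))
      (partition-⊆ p _ _ G) (onPivot-reduct (λ _ → sub1-reduct (chooseC-introduced a b)) (λ _ → sub2-reduct))
  premise (there (there (there (here refl)))) =
    Premise.invariant (nStr1 a b) _ (onPivot p (sub1 p (chooseC a b)) (subShift p a b)) (ℕ.≤ᵇ⇒≤ _ 9 _)
      (fresh-I⊙₃₄ (fresh-a,b refl))
      (partition-⊆ p _ _ G) (onPivot-reduct (λ _ → sub1-reduct (chooseC-introduced a b)) subShift-reduct)
  premise (there (there (there (there (here refl))))) =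
    Premise.invariant (nPre top a ++ nPre top b) _ (onPivot p (sub1 p top) (sub1 p top)) (ℕ.≤ᵇ⇒≤ _ 9 _)
      (All.++⁺ (FreshPair.fresh-nPre ⊤ sub₁ ⊤+a≤β) (FreshPair.fresh-nPre ⊤ sub₂ ⊤+b≤β))
      (partition‴-⊆ p _ G) (onPivot-reduct (λ _ → sub1-reduct ⊤) (λ _ → sub1-reduct ⊤))

⇒-premise-invariant : ∀ {ℓ m β G a b H} → Invariant ℓ (suc m) β G → a ⇒ b ∈ fmls G →
                      H ∈ premises (a ⇒ b) G → Invariant (ℓ + 9) m β H
⇒-premise-invariant {ℓ} {m} {β} {G} {a} {b} inv p∈G = premise
  where
  open RewritingStep a b inv p∈G refl refl refl
  p = a ⇒ b
  premise : ∀ {H} → H ∈ premises p G → Invariant (ℓ + 9) m β H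
  premise (here refl) =
    Premise.invariant (nLl b a) _ (sub1 p b) (ℕ.≤ᵇ⇒≤ _ 9 _) (FreshPair.fresh-nLl sub₂ sub₁ b+a≤β)
      (sub1-⊆ p b G) (sub1-reduct sub₂)
  premise (there (here refl)) =
    Premise.invariant (nStr b a) _ (onPivot p (sub1 p (chooseC a b)) (subImp p a b)) (ℕ.≤ᵇ⇒≤ _ 9 _)
      (FreshPair.fresh-nStr sub₂ sub₁ b+a≤β)
      (partition-⊆ p _ _ G) (onPivot-reduct (λ _ → sub1-reduct (chooseC-introduced a b)) (λ _ → subImp-reduct))
  premise (there (there (here refl))) =
    Premise.invariant (nLe a b) _ (onPivot p (sub1 p top) (sub1 p top)) (ℕ.≤ᵇ⇒≤ _ 9 _)
      (FreshPair.fresh-nLe sub₁ sub₂ a+b≤β)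
      (partition‴-⊆ p _ G) (onPivot-reduct (λ _ → sub1-reduct ⊤) (λ _ → sub1-reduct ⊤))

maxF-∈ : ∀ xs {m} → maxF xs ≡ just m → m ∈ xs
maxF-∈ (x ∷ xs) e with maxF xs in max≡
... | nothing = here (sym (just-injective e))
... | just m′ with m′ <c x
...   | true = here (sym (just-injective e))
...   | false = there (maxF-∈ xs (trans max≡ e))

pivot-∈ : ∀ G {p} → pivot G ≡ just p → p ∈ fmls G
pivot-∈ G e with maxF (fmls G) in max≡
... | just m with atomic m
...   | false = maxF-∈ (fmls G) (trans max≡ e)

child-invariant : ∀ {ℓ m β G H} → Invariant ℓ (suc m) β G → H ∈ children G → Invariant (ℓ + 9) m β H
child-invariant {G = G} inv H∈ with pivot G in pivot≡
... | just (a ⊙ b) = ⊙-premise-invariant inv (pivot-∈ G pivot≡) H∈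
... | just (a ⇒ b) = ⇒-premise-invariant inv (pivot-∈ G pivot≡) H∈

invariant-irreducible : ∀ {ℓ β G} → Invariant ℓ 0 β G → Irreducible G
invariant-irreducible {G = G} inv = All.all⁻ atomic (All.tabulate x-atomic)
  where
  open Invariant inv
  x-atomic : ∀ {x} → x ∈ fmls G → T (atomic x)
  x-atomic {x} x∈ with atomic x in atomic≡
  ... | true = _
  ... | false with () ← ℕ.≤-trans (compound⇒cc>0 x atomic≡)
                          (ℕ.≤-trans (ℕ.m≤m+n (cc x) _)
                            (ℕ.≤-trans (ℕ.≤-reflexive (sum-map-─ cc (pending-complete x∈ atomic≡))) pending-cc))

length-children≤5 : ∀ G → length (children G) ≤ 5
length-children≤5 G with pivot G
... | nothing = z≤n
... | just bot = z≤n
... | just top = z≤n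
... | just (var _) = z≤n
... | just (_ ⊙ _) = ℕ.≤-refl
... | just (_ ⇒ _) = ℕ.≤ᵇ⇒≤ 3 5 _

-- Sizes of the reduction

-- At most m further steps, each adding at most 9 sequents of size at most 2β + 1.
nodeBound : ℕ → ℕ → ℕ → ℕ
nodeBound ℓ m β = (ℓ + m * 9) * suc (β + β)

sizeHS≤nodeBound : ∀ {ℓ m β G} → Invariant ℓ m β G → sizeHS G ≤ nodeBound ℓ m β
sizeHS≤nodeBound {ℓ} {m} {β} {G} inv =
  ℕ.≤-trans (sum-map≤length* sizeSeq G (sizeSeq≤ ∘ sequents-bounded))
            (ℕ.*-monoˡ-≤ (suc (β + β)) (ℕ.≤-trans length≤ (ℕ.m≤m+n ℓ (m * 9))))
  where open Invariant inv

nodeBound-child : ∀ ℓ m β → nodeBound (ℓ + 9) m β ≡ nodeBound ℓ (suc m) β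
nodeBound-child ℓ m β = cong (_* suc (β + β)) (ℕ.+-assoc ℓ 9 (m * 9))

branchSize≤ : ∀ {ℓ m β G bs} → Invariant ℓ m β G → Branch G bs → branchSize bs ≤ suc m * nodeBound ℓ m β
branchSize≤ inv (leaf _) = ℕ.+-mono-≤ (sizeHS≤nodeBound inv) z≤n
branchSize≤ {m = zero} inv (step reducible _ _) = ⊥-elim (reducible (invariant-irreducible inv))
branchSize≤ {ℓ} {suc m} {β} {bs = _ ∷ bs} inv (step _ H∈ branch) =
  ℕ.+-mono-≤ (sizeHS≤nodeBound inv)
    (subst (λ k → branchSize bs ≤ suc m * k) (nodeBound-child ℓ m β)
           (branchSize≤ (child-invariant inv H∈) branch))

treeSize≤ : ∀ m {ℓ β G} → Invariant ℓ m β G → ∃ λ s → TreeSize G s × s ≤ 6 ^ m * nodeBound ℓ m β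
treeSize≤ m {G = G} inv with T? (all atomic (fmls G))
... | yes irreducible =
  sizeHS G , leaf irreducible , ℕ.≤-trans (sizeHS≤nodeBound inv) (ℕ.m≤n*m _ (6 ^ m) {{ℕ.m^n≢0 6 m}})
treeSize≤ zero inv | no reducible = ⊥-elim (reducible (invariant-irreducible inv))
treeSize≤ (suc m) {ℓ} {β} {G} inv | no reducible =
  let ss , subtrees , sum≤ = pointwise-sum≤ (children G) subtree
  in sizeHS G + sum ss , node reducible subtrees , (begin
    sizeHS G + sum ss                             ≤⟨ ℕ.+-mono-≤ (ℕ.≤-trans (sizeHS≤nodeBound inv) N≤6^m*N) sum≤ ⟩
    6 ^ m * N + length (children G) * (6 ^ m * N) ≤⟨ ℕ.+-monoʳ-≤ _ (ℕ.*-monoˡ-≤ (6 ^ m * N) (length-children≤5 G)) ⟩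
    6 * (6 ^ m * N)                               ≡⟨ ℕ.*-assoc 6 (6 ^ m) N ⟨
    6 ^ suc m * N                                 ∎)
  where
  open ℕ.≤-Reasoning
  N = nodeBound ℓ (suc m) β
  N≤6^m*N : N ≤ 6 ^ m * N
  N≤6^m*N = ℕ.m≤n*m N (6 ^ m) {{ℕ.m^n≢0 6 m}}
  subtree : ∀ {H} → H ∈ children G → ∃ λ s → TreeSize H s × s ≤ 6 ^ m * N
  subtree {H} H∈ = subst (λ k → ∃ λ s → TreeSize H s × s ≤ 6 ^ m * k) (nodeBound-child ℓ m β)
                         (treeSize≤ m (child-invariant inv H∈))

root-invariant : ∀ A → Invariant 1 (cc A) (suc (sizeF A)) (root A)
root-invariant A = record
  { length≤ = ℕ.≤-refl
  ; sequents-bounded = λ { (here refl) →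
      bounded (top ∷ []) (A ∷ []) [] ↭-refl ↭-refl
              (ℕ.≤-reflexive (cong suc (trans (ℕ.+-identityʳ _) (ℕ.+-identityʳ _)))) }
  ; pending = A ∷ []
  ; pending-complete = λ { (here refl) () ; (there (here refl)) _ → here refl }
  ; pending-cc = ℕ.≤-reflexive (ℕ.+-identityʳ (cc A))
  }

suc[m+m]+suc[n+n]≡suc[m+n]+suc[m+n] : ∀ m n → suc (m + m) + suc (n + n) ≡ suc (m + n) + suc (m + n)
suc[m+m]+suc[n+n]≡suc[m+n]+suc[m+n] = solve-∀

sizeF≡1+2cc : ∀ x → sizeF x ≡ suc (cc x + cc x)
sizeF≡1+2cc bot = refl
sizeF≡1+2cc top = refl
sizeF≡1+2cc (var _) = refl
sizeF≡1+2cc (a ⊙ b) rewrite sizeF≡1+2cc a | sizeF≡1+2cc b =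
  cong suc (suc[m+m]+suc[n+n]≡suc[m+n]+suc[m+n] (cc a) (cc b))
sizeF≡1+2cc (a ⇒ b) rewrite sizeF≡1+2cc a | sizeF≡1+2cc b =
  cong suc (suc[m+m]+suc[n+n]≡suc[m+n]+suc[m+n] (cc a) (cc b))

nodeBound-root≤ : ∀ A → nodeBound 1 (cc A) (suc (sizeF A)) ≤ 45 * (suc (cc A) * suc (cc A))
nodeBound-root≤ A rewrite sizeF≡1+2cc A =
  subst (nodeBound 1 n (suc (suc (n + n))) ≤_) (slack n) (ℕ.m≤m+n _ (9 * n * n + 41 * n + 40))
  where
  n = cc A
  slack : ∀ n → (1 + n * 9) * suc (suc (suc (n + n)) + suc (suc (n + n))) + (9 * n * n + 41 * n + 40)
                ≡ 45 * (suc n * suc n)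
  slack = solve-∀

n≤2^n : ∀ n → n ≤ 2 ^ n
n≤2^n zero = z≤n
n≤2^n (suc n) = ℕ.+-mono-≤ (ℕ.m^n>0 2 n) (subst (n ≤_) (sym (ℕ.+-identityʳ (2 ^ n))) (n≤2^n n))

6^n*45[1+n]²≤2^[45*[1+n]] : ∀ n → 6 ^ n * (45 * (suc n * suc n)) ≤ 2 ^ (45 * suc n)
6^n*45[1+n]²≤2^[45*[1+n]] n = begin
  6 ^ n * (45 * (x * x))                  ≤⟨ ℕ.*-mono-≤ (ℕ.^-monoˡ-≤ n (ℕ.≤ᵇ⇒≤ 6 8 _))
                                               (ℕ.*-mono-≤ (ℕ.≤ᵇ⇒≤ 45 64 _) (ℕ.*-mono-≤ (n≤2^n x) (n≤2^n x))) ⟩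
  (2 ^ 3) ^ n * (2 ^ 6 * (2 ^ x * 2 ^ x)) ≡⟨ cong₂ _*_ (ℕ.^-*-assoc 2 3 n)
                                               (cong (2 ^ 6 *_) (sym (ℕ.^-distribˡ-+-* 2 x x))) ⟩
  2 ^ (3 * n) * (2 ^ 6 * 2 ^ (x + x))     ≡⟨ cong (2 ^ (3 * n) *_) (ℕ.^-distribˡ-+-* 2 6 (x + x)) ⟨
  2 ^ (3 * n) * 2 ^ (6 + (x + x))         ≡⟨ ℕ.^-distribˡ-+-* 2 (3 * n) (6 + (x + x)) ⟨
  2 ^ (3 * n + (6 + (x + x)))             ≤⟨ ℕ.^-monoʳ-≤ 2 (subst (3 * n + (6 + (x + x)) ≤_) (slack n)
                                                                 (ℕ.m≤m+n _ (40 * n + 37))) ⟩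
  2 ^ (45 * x)                            ∎
  where
  open ℕ.≤-Reasoning
  x = suc n
  slack : ∀ n → 3 * n + (6 + (suc n + suc n)) + (40 * n + 37) ≡ 45 * suc n
  slack = solve-∀

branchSize-root≤ : ∀ A → suc (cc A) * nodeBound 1 (cc A) (suc (sizeF A)) ≤ 45 * suc (cc A) ^ 3
branchSize-root≤ A = ℕ.≤-trans (ℕ.*-monoʳ-≤ (suc (cc A)) (nodeBound-root≤ A)) (ℕ.≤-reflexive (cube (cc A)))
  where cube : ∀ n → suc n * (45 * (suc n * suc n)) ≡ 45 * (suc n * (suc n * (suc n * 1)))
        cube = solve-∀

treeSize-root≤ : ∀ A → 6 ^ cc A * nodeBound 1 (cc A) (suc (sizeF A)) ≤ 2 ^ (45 * suc (cc A))
treeSize-root≤ A = ℕ.≤-trans (ℕ.*-monoʳ-≤ (6 ^ cc A) (nodeBound-root≤ A)) (6^n*45[1+n]²≤2^[45*[1+n]] (cc A))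

lemma5p2 : Σ ℕ λ k → (A : Fm) →
    ((b : List HS) → Branch (root A) b → branchSize b ≤ k * (suc (cc A) ^ 3))
    × (Σ ℕ λ s → TreeSize (root A) s × s ≤ 2 ^ (k * suc (cc A)))
lemma5p2 = 45 , λ A →
  (λ b branch → ℕ.≤-trans (branchSize≤ (root-invariant A) branch) (branchSize-root≤ A)) ,
  (let s , tree , s≤ = treeSize≤ (cc A) (root-invariant A) in s , tree , ℕ.≤-trans s≤ (treeSize-root≤ A))
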